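{- Let $p$ be a prime. Let $t_1,t_2,f$ be positive integers with $t_1,t_2>2$ and $f^2>(t_1^2-4)(t_2^2-4)$, and put $\beta_p=\nu_p\big(f^2-(t_1^2-4)(t_2^2-4)\big)$. Then the Hilbert symbol $\big(t_2^2-4,\ f^2-(t_1^2-4)(t_2^2-4)\big)_p$ is determined by the residues of $t_1,t_2,f$ modulo $p^{\beta_p+1+\nu_p(16)}$; that is, if $t_1',t_2',f'$ are positive integers with $t_1',t_2'>2$, $f'^2>(t_1'^2-4)(t_2'^2-4)$ and $t_1'\equiv t_1$, $t_2'\equiv t_2$, $f'\equiv f \pmod{p^{\beta_p+1+\nu_p(16)}}$, then $$\big(t_2'^2-4,\ f'^2-(t_1'^2-4)(t_2'^2-4)\big)_p=\big(t_2^2-4,\ f^2-(t_1^2-4)(t_2^2-4)\big)_p.$$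
   Context: $\nu_p(n)$ is the exponent of $p$ in the nonzero integer $n$ (so $\nu_p(16)=4$ if $p=2$ and $0$ otherwise). $(x,y)_p$ is the Hilbert symbol over $\mathbb Q_p$. -}

module Defs where

open import Data.Nat using (ℕ; suc; _^_)
open import Data.Integer using (ℤ; +_; _-_; _*_)
open import Data.Integer.Divisibility using (_∣_)
open import Data.Product using (Σ; ∃; _×_)
open import Data.Sum using (_⊎_)
open import Relation.Nullary using (¬_)

_≡_[mod_] : ℤ → ℤ → ℕ → Set
a ≡ b [mod m ] = (+ m) ∣ (a - b)

IsVal : ℕ → ℤ → ℕ → Set
IsVal p n v = ((+ (p ^ v)) ∣ n) × ¬ ((+ (p ^ suc v)) ∣ n)

-- p-adic integers ℤ_p = lim ℤ/p^k ℤ, as coherent sequences of integer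
-- representatives: seq k represents the residue modulo p^k.
record Zp (p : ℕ) : Set where
  field
    seq : ℕ → ℤ
    coh : ∀ k → seq (suc k) ≡ seq k [mod p ^ k ]
open Zp public

NonZeroₚ : ∀ {p} → Zp p → Set
NonZeroₚ {p} x = ∃ λ k → ¬ ((+ (p ^ k)) ∣ seq x k)

-- The Hilbert symbol (a,b)_p equals 1, i.e. z² = a x² + b y² has a
-- nontrivial solution; for a, b ∈ ℤ a nontrivial solution in ℚ_p³ exists
-- iff one exists in ℤ_p³ (clear denominators), which is what is stated.
HilbertOne : ℕ → ℤ → ℤ → Set
HilbertOne p a b =
  Σ (Zp p) λ x → Σ (Zp p) λ y → Σ (Zp p) λ z →
    (NonZeroₚ x ⊎ NonZeroₚ y ⊎ NonZeroₚ z) ×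
    (∀ k → (seq z k * seq z k) ≡ (a * (seq x k * seq x k) + b * (seq y k * seq y k)) [mod p ^ k ])
  where open Data.Integer using (_+_)

tm : ℕ → ℤ
tm t = (+ t) * (+ t) - + 4

disc : ℕ → ℕ → ℕ → ℤ
disc t₁ t₂ f = (+ f) * (+ f) - tm t₁ * tm t₂

{-# OPTIONS --safe #-}
-- Write δ = ν_p(2), so that ν_p(16) = 4δ. Hensel's lemma in the form "r² ≡ B mod p^(2ν(2r)+1)
-- implies that B is the square of a nonzero p-adic integer" shows that x' ≡ x mod p^(ν(x)+2δ+1)
-- makes x x' such a square, and (a, b)_p only depends on the square classes of a and b.
-- With a = t₂² - 4 and b = f² - (t₁² - 4) a of valuation β: if ν(a) ≤ β + 2δ, then a a' and b b'
-- are squares, so the two symbols agree. Otherwise p^(β+2δ+1) divides a and a', so b ≡ f² and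
-- b' ≡ f'² modulo p^(β+2δ+1); this forces ν(f) = β/2, Hensel makes b and b' squares, and both
-- symbols equal 1.
module Submission where

open import Defs
open import Data.Nat using (ℕ; _+_; _^_; _<_)
open import Data.Nat.Primality using (Prime)
open import Data.Integer using (+_)
open import Function.Bundles using (_⇔_)
import Data.Integer as ℤ

open import Function.Bundles using (mk⇔)

open import Data.Nat using (zero; suc; s≤s; _≤_; _≤?_; _≤′_; ≤′-refl; ≤′-step)
import Data.Nat as ℕ
import Data.Nat.Divisibility as ℕ
open import Data.Nat.GCD using (module Bézout)
open import Data.Nat.Coprimality using (Coprime; coprime-Bézout)
open import Data.Nat.Primality using (prime⇒nonZero; prime⇒irreducible; euclidsLemma)
import Data.Nat.Properties as ℕₚ
open import Data.Integer using (ℤ; _*_; _-_; -_; 0ℤ; 1ℤ)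
import Data.Integer.Properties as ℤₚ
import Data.Integer.Divisibility as Unsigned
import Data.Integer.Divisibility.Signed as Signed
open import Data.Integer.Tactic.RingSolver using (solve-∀)
open import Data.Nat.Tactic.RingSolver renaming (solve-∀ to ℕ-solve-∀)
open import Data.Product using (Σ; ∃; _×_; _,_; proj₁; proj₂)
open import Data.Sum using (_⊎_; inj₁; inj₂; [_,_]′)
open import Data.Empty using (⊥-elim)
open import Function.Base using (_∘_)
open import Relation.Nullary using (¬_; Dec; yes; no)
open import Relation.Nullary.Decidable using (map′)
open import Relation.Binary.PropositionalEquality
  using (_≡_; refl; sym; trans; cong; cong₂; subst; subst₂; module ≡-Reasoning)

module PowerDivisibility (p : ℕ) where

  private variable
    k m n K N : ℕ
    x y x' y' : ℤ

  -- Records rather than synonyms, so that the arguments can be inferred by unification.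
  infix 4 p^_∣_
  record p^_∣_ (k : ℕ) (x : ℤ) : Set where
    constructor p^∣
    field divisibility : + (p ^ k) Signed.∣ x

  ∣ᵤ⇒p^∣ : + (p ^ k) Unsigned.∣ x → p^ k ∣ x
  ∣ᵤ⇒p^∣ d = p^∣ (Signed.∣ᵤ⇒∣ d)

  p^∣⇒∣ᵤ : p^ k ∣ x → + (p ^ k) Unsigned.∣ x
  p^∣⇒∣ᵤ (p^∣ d) = Signed.∣⇒∣ᵤ d

  p^∣? : ∀ k x → Dec (p^ k ∣ x)
  p^∣? k x = map′ p^∣ p^_∣_.divisibility (+ (p ^ k) Signed.∣? x)

  p^-+ : ∀ m n → + (p ^ (m + n)) ≡ + (p ^ m) * + (p ^ n)
  p^-+ m n = trans (cong +_ (ℕₚ.^-distribˡ-+-* p m n)) (ℤₚ.pos-* (p ^ m) (p ^ n))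

  p^0∣x : p^ 0 ∣ x
  p^0∣x {x = x} = p^∣ (Signed.divides x (sym (ℤₚ.*-identityʳ x)))

  ∣0 : p^ k ∣ 0ℤ
  ∣0 = p^∣ (Signed.divides 0ℤ refl)

  ∣x∣y⇒∣x+y : p^ k ∣ x → p^ k ∣ y → p^ k ∣ x ℤ.+ y
  ∣x∣y⇒∣x+y (p^∣ d) (p^∣ e) = p^∣ (Signed.∣m∣n⇒∣m+n d e)

  ∣x∣y⇒∣x-y : p^ k ∣ x → p^ k ∣ y → p^ k ∣ x - y
  ∣x∣y⇒∣x-y (p^∣ d) (p^∣ e) = p^∣ (Signed.∣m∣n⇒∣m-n d e)

  ∣x⇒∣-x : p^ k ∣ x → p^ k ∣ - x
  ∣x⇒∣-x (p^∣ d) = p^∣ (Signed.∣m⇒∣-m d)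

  ∣y⇒∣x*y : ∀ x → p^ k ∣ y → p^ k ∣ x * y
  ∣y⇒∣x*y x (p^∣ d) = p^∣ (Signed.∣n⇒∣m*n x d)

  ∣x⇒∣x*y : ∀ y → p^ k ∣ x → p^ k ∣ x * y
  ∣x⇒∣x*y y (p^∣ d) = p^∣ (Signed.∣m⇒∣m*n y d)

  ∣x∣y⇒∣x*y : p^ m ∣ x → p^ n ∣ y → p^ m + n ∣ x * y
  ∣x∣y⇒∣x*y {m = m} {x = x} {n = n} (p^∣ d) (p^∣ e) = p^∣ (subst (Signed._∣ x * _) (sym (p^-+ m n))
    (Signed.∣-trans (Signed.*-monoˡ-∣ (+ (p ^ n)) d) (Signed.*-monoʳ-∣ x e)))

  p^n∣p^n : ∀ n → p^ n ∣ + (p ^ n)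
  p^n∣p^n n = p^∣ Signed.∣-refl

  p^m∣p^n : m ≤ n → p^ m ∣ + (p ^ n)
  p^m∣p^n {m = m} m≤n with ℕₚ.m≤n⇒∃[o]m+o≡n m≤n
  ... | o , refl = subst (p^ m ∣_) (sym (p^-+ m o)) (∣x⇒∣x*y (+ (p ^ o)) (p^n∣p^n m))

  ∣-weaken : m ≤ n → p^ n ∣ x → p^ m ∣ x
  ∣-weaken m≤n (p^∣ d) = p^∣ (Signed.∣-trans (p^_∣_.divisibility (p^m∣p^n m≤n)) d)

  infix 4 _≡_[mod-p^_]
  record _≡_[mod-p^_] (x y : ℤ) (k : ℕ) : Set where
    constructor ≡-mod
    field ≡-mod⇒∣ : p^ k ∣ x - y
  open _≡_[mod-p^_] public

  ≡-modᵤ⇒≡-mod : ∀ x y → x ≡ y [mod p ^ k ] → x ≡ y [mod-p^ k ]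
  ≡-modᵤ⇒≡-mod x y d = ≡-mod (∣ᵤ⇒p^∣ d)

  ≡-mod-refl : x ≡ x [mod-p^ k ]
  ≡-mod-refl {x = x} = ≡-mod (subst (p^ _ ∣_) (sym (ℤₚ.+-inverseʳ x)) ∣0)

  ≡-mod-sym : x ≡ y [mod-p^ k ] → y ≡ x [mod-p^ k ]
  ≡-mod-sym {x = x} {y = y} (≡-mod d) = ≡-mod (subst (p^ _ ∣_) (negate-difference x y) (∣x⇒∣-x d))
    where
    negate-difference : ∀ x y → - (x - y) ≡ y - x
    negate-difference = solve-∀

  ≡-mod-trans : x ≡ y [mod-p^ k ] → y ≡ x' [mod-p^ k ] → x ≡ x' [mod-p^ k ]
  ≡-mod-trans {x = x} {y = y} {x' = x'} (≡-mod d) (≡-mod e) =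
    ≡-mod (subst (p^ _ ∣_) (ℤₚ.+-minus-telescope x y x') (∣x∣y⇒∣x+y d e))

  ≡-mod-weaken : m ≤ n → x ≡ y [mod-p^ n ] → x ≡ y [mod-p^ m ]
  ≡-mod-weaken m≤n (≡-mod d) = ≡-mod (∣-weaken m≤n d)

  ≡-mod-minus : x ≡ x' [mod-p^ k ] → y ≡ y' [mod-p^ k ] → x - y ≡ x' - y' [mod-p^ k ]
  ≡-mod-minus {x = x} {x' = x'} {y = y} {y' = y'} (≡-mod d) (≡-mod e) =
    ≡-mod (subst (p^ _ ∣_) (difference-of-differences x x' y y') (∣x∣y⇒∣x-y d e))
    where
    difference-of-differences : ∀ x x' y y' → (x - x') - (y - y') ≡ (x - y) - (x' - y')
    difference-of-differences = solve-∀

  ≡-mod-* : x ≡ x' [mod-p^ k ] → y ≡ y' [mod-p^ k ] → x * y ≡ x' * y' [mod-p^ k ]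
  ≡-mod-* {x = x} {x' = x'} {y = y} {y' = y'} (≡-mod d) (≡-mod e) =
    ≡-mod (subst (p^ _ ∣_) (difference-of-products x x' y y') (∣x∣y⇒∣x+y (∣x⇒∣x*y y d) (∣y⇒∣x*y x' e)))
    where
    difference-of-products : ∀ x x' y y' → (x - x') * y ℤ.+ x' * (y - y') ≡ x * y - x' * y'
    difference-of-products = solve-∀

  ∣-resp-≡-mod : x ≡ y [mod-p^ k ] → p^ k ∣ x → p^ k ∣ y
  ∣-resp-≡-mod {x = x} {y = y} (≡-mod x≡y) d = subst (p^ _ ∣_) (cancel x y) (∣x∣y⇒∣x-y d x≡y)
    where
    cancel : ∀ x y → x - (x - y) ≡ y
    cancel = solve-∀

  HasVal : ℤ → ℕ → Set
  HasVal x m = p^ m ∣ x × ¬ p^ suc m ∣ x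

  isVal⇒hasVal : IsVal p x m → HasVal x m
  isVal⇒hasVal (d , ¬d) = ∣ᵤ⇒p^∣ d , λ d' → ¬d (p^∣⇒∣ᵤ d')

  hasVal⇒¬∣ : HasVal x m → m < K → ¬ p^ K ∣ x
  hasVal⇒¬∣ (_ , ¬d) m<K d = ¬d (∣-weaken m<K d)

  ∣⇒≤val : HasVal x m → p^ n ∣ x → n ≤ m
  ∣⇒≤val {m = m} {n = n} v d with n ≤? m
  ... | yes n≤m = n≤m
  ... | no n≰m = ⊥-elim (hasVal⇒¬∣ v (ℕₚ.≰⇒> n≰m) d)

  hasVal-unique : HasVal x m → HasVal x n → m ≡ n
  hasVal-unique vm vn = ℕₚ.≤-antisym (∣⇒≤val vn (proj₁ vm)) (∣⇒≤val vm (proj₁ vn))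

  hasVal-below : ¬ p^ K ∣ x → ∃ λ m → m < K × HasVal x m
  hasVal-below {K = zero} ¬d = ⊥-elim (¬d p^0∣x)
  hasVal-below {K = suc K} {x = x} ¬d with p^∣? K x
  ... | yes d = K , ℕₚ.n<1+n K , d , ¬d
  ... | no ¬d' with hasVal-below ¬d'
  ...   | m , m<K , v = m , ℕₚ.m<n⇒m<1+n m<K , v

  hasVal-cong : m < N → x ≡ x' [mod-p^ N ] → HasVal x m → HasVal x' m
  hasVal-cong m<N x≡x' (d , ¬d) =
      ∣-resp-≡-mod (≡-mod-weaken (ℕₚ.<⇒≤ m<N) x≡x') d
    , λ d' → ¬d (∣-resp-≡-mod (≡-mod-weaken m<N (≡-mod-sym x≡x')) d')

  constₚ : ℤ → Zp p
  constₚ x = record { seq = λ _ → x ; coh = λ k → p^∣⇒∣ᵤ (≡-mod⇒∣ (≡-mod-refl {x = x} {k = k})) }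

  seq-coh : (a : Zp p) → ∀ k → seq a (suc k) ≡ seq a k [mod-p^ k ]
  seq-coh a k = ≡-mod (∣ᵤ⇒p^∣ (coh a k))

  seq-≡-mod : (a : Zp p) → k ≤ K → seq a K ≡ seq a k [mod-p^ k ]
  seq-≡-mod a k≤K = go (ℕₚ.≤⇒≤′ k≤K)
    where
    go : k ≤′ K → seq a K ≡ seq a k [mod-p^ k ]
    go ≤′-refl = ≡-mod-refl
    go {K = suc K} (≤′-step k≤′K) = ≡-mod-trans (≡-mod-weaken (ℕₚ.≤′⇒≤ k≤′K) (seq-coh a K)) (go k≤′K)

  infixl 7 _*ₚ_
  _*ₚ_ : Zp p → Zp p → Zp p
  a *ₚ b = record
    { seq = λ k → seq a k * seq b k
    ; coh = λ k → p^∣⇒∣ᵤ (≡-mod⇒∣ (≡-mod-* (seq-coh a k) (seq-coh b k)))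
    }

  nonZeroₚ-const : ¬ p^ k ∣ x → NonZeroₚ (constₚ x)
  nonZeroₚ-const {k = k} ¬d = k , λ d → ¬d (∣ᵤ⇒p^∣ d)

  IsSquareₚ : ℤ → Set
  IsSquareₚ B = Σ (Zp p) λ w → NonZeroₚ w × (∀ k → seq w k * seq w k ≡ B [mod-p^ k ])

  square⇒HilbertOne : ∀ a b → IsSquareₚ b → HilbertOne p a b
  square⇒HilbertOne a b (w , w≢0 , w²≡b) =
    constₚ 0ℤ , constₚ 1ℤ , w , inj₂ (inj₂ w≢0) , λ k →
      p^∣⇒∣ᵤ (subst (p^ k ∣_) (sym (drop-x-y a b (seq w k))) (≡-mod⇒∣ (w²≡b k)))
    where
    drop-x-y : ∀ a b W → W * W - (a * (0ℤ * 0ℤ) ℤ.+ b * (1ℤ * 1ℤ)) ≡ W * W - b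
    drop-x-y = solve-∀

  HilbertOne-swap : ∀ a b → HilbertOne p a b → HilbertOne p b a
  HilbertOne-swap a b (x , y , z , x≢0⊎y≢0⊎z≢0 , z²≡ax²+by²) =
    y , x , z , swap-≢0 x≢0⊎y≢0⊎z≢0 , λ k →
      subst (λ t → + (p ^ k) Unsigned.∣ seq z k * seq z k - t)
            (ℤₚ.+-comm (a * (seq x k * seq x k)) (b * (seq y k * seq y k))) (z²≡ax²+by² k)
    where
    swap-≢0 : NonZeroₚ x ⊎ NonZeroₚ y ⊎ NonZeroₚ z → NonZeroₚ y ⊎ NonZeroₚ x ⊎ NonZeroₚ z
    swap-≢0 (inj₁ x≢0) = inj₂ (inj₁ x≢0)
    swap-≢0 (inj₂ (inj₁ y≢0)) = inj₁ y≢0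
    swap-≢0 (inj₂ (inj₂ z≢0)) = inj₂ (inj₂ z≢0)

  valuation-of-2 : ∀ {e} → HasVal (+ 16) e → ∃ λ δ → HasVal (+ 2) δ × δ + δ + (δ + δ) ≤ e
  valuation-of-2 {e} v₁₆ =
    let δ , _ , v₂ = hasVal-below {K = suc e} (λ p^∣2 → proj₂ v₁₆ (∣y⇒∣x*y (+ 8) p^∣2))
        p^δ∣2 = proj₁ v₂
    in δ , v₂ , ∣⇒≤val v₁₆ (∣x∣y⇒∣x*y (∣x∣y⇒∣x*y p^δ∣2 p^δ∣2) (∣x∣y⇒∣x*y p^δ∣2 p^δ∣2))

  tm-cong : ∀ {s t} → + s ≡ + t [mod-p^ k ] → tm s ≡ tm t [mod-p^ k ]
  tm-cong s≡t = ≡-mod-minus (≡-mod-* s≡t s≡t) ≡-mod-refl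

  disc-cong : ∀ {s₁ s₂ g t₁ t₂ f} →
              + s₁ ≡ + t₁ [mod-p^ k ] → + s₂ ≡ + t₂ [mod-p^ k ] → + g ≡ + f [mod-p^ k ] →
              disc s₁ s₂ g ≡ disc t₁ t₂ f [mod-p^ k ]
  disc-cong s₁≡t₁ s₂≡t₂ g≡f = ≡-mod-minus (≡-mod-* g≡f g≡f) (≡-mod-* (tm-cong s₁≡t₁) (tm-cong s₂≡t₂))

module PrimePowerDivisibility (p : ℕ) (p-prime : Prime p) where

  open PowerDivisibility p public

  private
    instance
      p≢0 : ℕ.NonZero p
      p≢0 = prime⇒nonZero p-prime

    variable
      k m n : ℕ
      x y u : ℤ

  p^1∣⇒p∣∣_∣ : ∀ x → p^ 1 ∣ x → p ℕ.∣ ℤ.∣ x ∣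
  p^1∣⇒p∣∣ x ∣ d = subst (ℕ._∣ ℤ.∣ x ∣) (ℕₚ.^-identityʳ p) (p^∣⇒∣ᵤ d)

  p∣∣_∣⇒p^1∣ : ∀ x → p ℕ.∣ ℤ.∣ x ∣ → p^ 1 ∣ x
  p∣∣ x ∣⇒p^1∣ d = ∣ᵤ⇒p^∣ (subst (ℕ._∣ ℤ.∣ x ∣) (sym (ℕₚ.^-identityʳ p)) d)

  p^1∣p : p^ 1 ∣ + p
  p^1∣p = p∣∣ + p ∣⇒p^1∣ ℕ.∣-refl

  p∣xy⇒p∣x⊎p∣y : p^ 1 ∣ x * y → p^ 1 ∣ x ⊎ p^ 1 ∣ y
  p∣xy⇒p∣x⊎p∣y {x = x} {y = y} d
    with euclidsLemma ℤ.∣ x ∣ ℤ.∣ y ∣ p-prime (subst (p ℕ.∣_) (ℤₚ.abs-* x y) (p^1∣⇒p∣∣ x * y ∣ d))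
  ... | inj₁ p∣x = inj₁ (p∣∣ x ∣⇒p^1∣ p∣x)
  ... | inj₂ p∣y = inj₂ (p∣∣ y ∣⇒p^1∣ p∣y)

  ∣x*p^n⇒∣x : ∀ k n → p^ k + n ∣ x * + (p ^ n) → p^ k ∣ x
  ∣x*p^n⇒∣x k n (p^∣ d) =
    p^∣ (Signed.*-cancelʳ-∣ (+ (p ^ n)) {{ℕₚ.m^n≢0 p n}} (subst (Signed._∣ _) (p^-+ k n) d))

  hasVal⇒unit-factor : HasVal x m → ∃ λ u → ¬ p^ 1 ∣ u × x ≡ u * + (p ^ m)
  hasVal⇒unit-factor {m = m} (p^∣ (Signed.divides u x≡u*p^m) , ¬d) =
    u , (λ p∣u → ¬d (subst (p^ suc m ∣_) (sym x≡u*p^m) (∣x∣y⇒∣x*y p∣u (p^n∣p^n m)))) , x≡u*p^m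

  hasVal-* : HasVal x m → HasVal y n → HasVal (x * y) (m + n)
  hasVal-* {x = x} {m = m} {y = y} {n = n} vx vy
    with hasVal⇒unit-factor vx | hasVal⇒unit-factor vy
  ... | u , p∤u , x≡u*p^m | v , p∤v , y≡v*p^n =
      ∣x∣y⇒∣x*y (proj₁ vx) (proj₁ vy)
    , λ d → [ p∤u , p∤v ]′
              (p∣xy⇒p∣x⊎p∣y (∣x*p^n⇒∣x 1 (m + n) (subst (p^ suc (m + n) ∣_) xy≡uv*p^[m+n] d)))
    where
    open ≡-Reasoning
    interchange : ∀ a b c d → (a * b) * (c * d) ≡ (a * c) * (b * d)
    interchange = solve-∀
    xy≡uv*p^[m+n] : x * y ≡ (u * v) * + (p ^ (m + n))
    xy≡uv*p^[m+n] = begin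
      x * y                                   ≡⟨ cong₂ _*_ x≡u*p^m y≡v*p^n ⟩
      (u * + (p ^ m)) * (v * + (p ^ n))       ≡⟨ interchange u _ v _ ⟩
      (u * v) * (+ (p ^ m) * + (p ^ n))       ≡⟨ cong (u * v *_) (p^-+ m n) ⟨
      (u * v) * + (p ^ (m + n))               ∎

  ℕ-bézout⇒ℤ : ∀ a b c d → 1 + a ℕ.* b ≡ c ℕ.* d → 1ℤ ℤ.+ + a * + b ≡ + c * + d
  ℕ-bézout⇒ℤ a b c d eq = begin
    1ℤ ℤ.+ + a * + b    ≡⟨ cong (λ z → 1ℤ ℤ.+ z) (ℤₚ.pos-* a b) ⟨
    1ℤ ℤ.+ + (a ℕ.* b)  ≡⟨ ℤₚ.pos-+ 1 (a ℕ.* b) ⟨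
    + (1 + a ℕ.* b)     ≡⟨ cong +_ eq ⟩
    + (c ℕ.* d)         ≡⟨ ℤₚ.pos-* c d ⟩
    + c * + d           ∎
    where open ≡-Reasoning

  bézout⇒inverse-mod-p : ∀ n → Bézout.Identity 1 p n → ∃ λ h → + n * h ≡ 1ℤ [mod-p^ 1 ]
  bézout⇒inverse-mod-p n (Bézout.+- a b 1+bn≡ap) =
    - + b , ≡-mod (subst (p^ 1 ∣_) (sym n[-b]-1≡-ap) (∣x⇒∣-x (∣y⇒∣x*y (+ a) p^1∣p)))
    where
    rearrange : ∀ n b → n * - b - 1ℤ ≡ - (1ℤ ℤ.+ b * n)
    rearrange = solve-∀
    n[-b]-1≡-ap : + n * - + b - 1ℤ ≡ - (+ a * + p)
    n[-b]-1≡-ap = trans (rearrange (+ n) (+ b)) (cong -_ (ℕ-bézout⇒ℤ b n a p 1+bn≡ap))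
  bézout⇒inverse-mod-p n (Bézout.-+ a b 1+ap≡bn) =
    + b , ≡-mod (subst (p^ 1 ∣_) (sym nb-1≡ap) (∣y⇒∣x*y (+ a) p^1∣p))
    where
    open ≡-Reasoning
    cancel : ∀ z → (1ℤ ℤ.+ z) - 1ℤ ≡ z
    cancel = solve-∀
    nb-1≡ap : + n * + b - 1ℤ ≡ + a * + p
    nb-1≡ap = begin
      + n * + b - 1ℤ                ≡⟨ cong (_- 1ℤ) (ℤₚ.*-comm (+ n) (+ b)) ⟩
      + b * + n - 1ℤ                ≡⟨ cong (_- 1ℤ) (ℕ-bézout⇒ℤ a p b n 1+ap≡bn) ⟨
      (1ℤ ℤ.+ + a * + p) - 1ℤ       ≡⟨ cancel (+ a * + p) ⟩
      + a * + p                     ∎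

  p∤x⇒p⊥∣x∣ : ¬ p^ 1 ∣ x → Coprime p ℤ.∣ x ∣
  p∤x⇒p⊥∣x∣ {x = x} p∤x (d∣p , d∣∣x∣) with prime⇒irreducible p-prime d∣p
  ... | inj₁ d≡1 = d≡1
  ... | inj₂ refl = ⊥-elim (p∤x (p∣∣ x ∣⇒p^1∣ d∣∣x∣))

  inverse-mod-p : ¬ p^ 1 ∣ u → ∃ λ h → u * h ≡ 1ℤ [mod-p^ 1 ]
  inverse-mod-p {u = u} p∤u
    with bézout⇒inverse-mod-p ℤ.∣ u ∣ (coprime-Bézout (p∤x⇒p⊥∣x∣ p∤u)) | ℤₚ.+∣i∣≡i⊎+∣i∣≡-i u
  ... | h , ∣u∣h≡1 | inj₁ ∣u∣≡u = h , subst (λ v → v * h ≡ 1ℤ [mod-p^ 1 ]) ∣u∣≡u ∣u∣h≡1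
  ... | h , ∣u∣h≡1 | inj₂ ∣u∣≡-u = - h , subst (_≡ 1ℤ [mod-p^ 1 ]) ∣u∣h≡u[-h] ∣u∣h≡1
    where
    ∣u∣h≡u[-h] : + ℤ.∣ u ∣ * h ≡ u * - h
    ∣u∣h≡u[-h] =
      trans (cong (_* h) ∣u∣≡-u) (trans (sym (ℤₚ.neg-distribˡ-* u h)) (ℤₚ.neg-distribʳ-* u h))

  nonZeroₚ-* : (a b : Zp p) → NonZeroₚ a → NonZeroₚ b → NonZeroₚ (a *ₚ b)
  nonZeroₚ-* a b (k , a≢0) (l , b≢0)
    with hasVal-below (λ d → a≢0 (p^∣⇒∣ᵤ d)) | hasVal-below (λ d → b≢0 (p^∣⇒∣ᵤ d))
  ... | m , m<k , va | n , n<l , vb =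
    k + l , λ d → hasVal⇒¬∣ (hasVal-* va' vb') (ℕₚ.+-mono-< m<k n<l) (∣ᵤ⇒p^∣ d)
    where
    va' : HasVal (seq a (k + l)) m
    va' = hasVal-cong m<k (≡-mod-sym (seq-≡-mod a (ℕₚ.m≤m+n k l))) va
    vb' : HasVal (seq b (k + l)) n
    vb' = hasVal-cong n<l (≡-mod-sym (seq-≡-mod b (ℕₚ.m≤n+m l k))) vb

  HilbertOne-rescale : ∀ a a' b (l ν : Zp p) → NonZeroₚ l → NonZeroₚ ν →
    (∀ k → a * (seq l k * seq l k) ≡ a' * (seq ν k * seq ν k) [mod-p^ k ]) →
    HilbertOne p a b → HilbertOne p a' b
  HilbertOne-rescale a a' b l ν l≢0 ν≢0 al²≡a'ν² (x , y , z , x≢0⊎y≢0⊎z≢0 , z²≡ax²+by²) =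
    νν *ₚ x , lν *ₚ y , lν *ₚ z , rescale-≢0 x≢0⊎y≢0⊎z≢0 , rescaled-solution
    where
    νν = ν *ₚ ν
    lν = l *ₚ ν
    rescale-≢0 : NonZeroₚ x ⊎ NonZeroₚ y ⊎ NonZeroₚ z →
                 NonZeroₚ (νν *ₚ x) ⊎ NonZeroₚ (lν *ₚ y) ⊎ NonZeroₚ (lν *ₚ z)
    rescale-≢0 (inj₁ x≢0) = inj₁ (nonZeroₚ-* νν x (nonZeroₚ-* ν ν ν≢0 ν≢0) x≢0)
    rescale-≢0 (inj₂ (inj₁ y≢0)) = inj₂ (inj₁ (nonZeroₚ-* lν y (nonZeroₚ-* l ν l≢0 ν≢0) y≢0))
    rescale-≢0 (inj₂ (inj₂ z≢0)) = inj₂ (inj₂ (nonZeroₚ-* lν z (nonZeroₚ-* l ν l≢0 ν≢0) z≢0))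
    identity : ∀ a a' b L V X Y Z →
        ((L * V) * Z) * ((L * V) * Z)
          - (a' * (((V * V) * X) * ((V * V) * X)) ℤ.+ b * (((L * V) * Y) * ((L * V) * Y)))
      ≡ (L * V) * (L * V) * (Z * Z - (a * (X * X) ℤ.+ b * (Y * Y)))
          ℤ.+ (V * X) * (V * X) * (a * (L * L) - a' * (V * V))
    identity = solve-∀
    rescaled-solution : ∀ k → let Z = seq (lν *ₚ z) k; X = seq (νν *ₚ x) k; Y = seq (lν *ₚ y) k in
                        (Z * Z) ≡ (a' * (X * X) ℤ.+ b * (Y * Y)) [mod p ^ k ]
    rescaled-solution k = p^∣⇒∣ᵤ (subst (p^ k ∣_) (sym (identity a a' b L V X Y Z))
      (∣x∣y⇒∣x+y (∣y⇒∣x*y ((L * V) * (L * V)) (∣ᵤ⇒p^∣ (z²≡ax²+by² k)))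
                 (∣y⇒∣x*y ((V * X) * (V * X)) (≡-mod⇒∣ (al²≡a'ν² k)))))
      where
      L = seq l k
      V = seq ν k
      X = seq x k
      Y = seq y k
      Z = seq z k

  HilbertOne-resp-square-class : ∀ a a' b → ¬ p^ k ∣ a → IsSquareₚ (a * a') →
                                 HilbertOne p a b → HilbertOne p a' b
  HilbertOne-resp-square-class a a' b a≢0 (w , w≢0 , w²≡aa') =
    HilbertOne-rescale a a' b w (constₚ a) w≢0 (nonZeroₚ-const a≢0) λ k → ≡-mod
      (subst (p^ k ∣_) (factor a a' (seq w k)) (∣y⇒∣x*y a (≡-mod⇒∣ (w²≡aa' k))))
    where
    factor : ∀ a a' W → a * (W * W - a * a') ≡ a * (W * W) - a' * (a * a)
    factor = solve-∀

  -- Newton's step for t ↦ t² - B: writing r² - B = q p^(n+e) and 2r = u p^n with u a unit,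
  -- the correction r' = r + t p^e with q + u t ≡ 0 (mod p) gains one digit of precision.
  hensel-step : ∀ {r B n e} → HasVal (+ 2 * r) n → n < e → r * r ≡ B [mod-p^ n + e ] →
                ∃ λ r' → r' * r' ≡ B [mod-p^ n + suc e ] × r' ≡ r [mod-p^ e ]
  hensel-step {r} {B} {n} {e} v n<e (≡-mod (p^∣ (Signed.divides q r²-B≡q*p^[n+e])))
    with hasVal⇒unit-factor v
  ... | u , p∤u , 2r≡u*p^n with inverse-mod-p p∤u
  ... | h , ≡-mod p∣uh-1 = r' , ≡-mod p^[n+1+e]∣r'²-B , ≡-mod p^e∣r'-r
    where
    open ≡-Reasoning
    P = + (p ^ n)
    π = + (p ^ e)
    t = - (q * h)
    r' = r ℤ.+ t * π

    expand : ∀ r B t π → (r ℤ.+ t * π) * (r ℤ.+ t * π) - B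
                         ≡ (r * r - B) ℤ.+ (+ 2 * r) * t * π ℤ.+ t * t * (π * π)
    expand = solve-∀
    collect : ∀ q u h P π → q * (P * π) ℤ.+ (u * P) * - (q * h) * π ≡ - q * ((u * h - 1ℤ) * P * π)
    collect = solve-∀
    r²-B≡qPπ : r * r - B ≡ q * (P * π)
    r²-B≡qPπ = trans r²-B≡q*p^[n+e] (cong (q *_) (p^-+ n e))
    r'²-B≡ : r' * r' - B ≡ - q * ((u * h - 1ℤ) * P * π) ℤ.+ t * t * (π * π)
    r'²-B≡ = begin
      r' * r' - B
        ≡⟨ expand r B t π ⟩
      (r * r - B) ℤ.+ (+ 2 * r) * t * π ℤ.+ t * t * (π * π)
        ≡⟨ cong₂ (λ a b → a ℤ.+ b * t * π ℤ.+ t * t * (π * π)) r²-B≡qPπ 2r≡u*p^n ⟩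
      q * (P * π) ℤ.+ (u * P) * t * π ℤ.+ t * t * (π * π)
        ≡⟨ cong (ℤ._+ t * t * (π * π)) (collect q u h P π) ⟩
      - q * ((u * h - 1ℤ) * P * π) ℤ.+ t * t * (π * π)
        ∎

    p^[n+1+e]∣q[uh-1]Pπ : p^ suc (n + e) ∣ - q * ((u * h - 1ℤ) * P * π)
    p^[n+1+e]∣q[uh-1]Pπ = ∣y⇒∣x*y (- q) (∣x∣y⇒∣x*y (∣x∣y⇒∣x*y p∣uh-1 (p^n∣p^n n)) (p^n∣p^n e))
    p^[n+1+e]∣t²π² : p^ suc (n + e) ∣ t * t * (π * π)
    p^[n+1+e]∣t²π² = ∣-weaken (ℕₚ.+-monoˡ-≤ e n<e) (∣y⇒∣x*y (t * t) (∣x∣y⇒∣x*y (p^n∣p^n e) (p^n∣p^n e)))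
    p^[n+1+e]∣r'²-B : p^ n + suc e ∣ r' * r' - B
    p^[n+1+e]∣r'²-B = subst (p^_∣ r' * r' - B) (sym (ℕₚ.+-suc n e))
      (subst (p^ suc (n + e) ∣_) (sym r'²-B≡) (∣x∣y⇒∣x+y p^[n+1+e]∣q[uh-1]Pπ p^[n+1+e]∣t²π²))

    cancel : ∀ r s → (r ℤ.+ s) - r ≡ s
    cancel = solve-∀
    p^e∣r'-r : p^ e ∣ r' - r
    p^e∣r'-r = subst (p^ e ∣_) (sym (cancel r (t * π))) (∣y⇒∣x*y t (p^n∣p^n e))

  hensel : ∀ {r₀ B n} → HasVal (+ 2 * r₀) n → r₀ * r₀ ≡ B [mod-p^ n + suc n ] → IsSquareₚ B
  hensel {r₀} {B} {n} v r₀²≡B = root , root≢0 , root²≡B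
    where
    Approximates : ℕ → ℤ → Set
    Approximates j r = r * r ≡ B [mod-p^ n + (j + suc n) ] × r ≡ r₀ [mod-p^ suc n ]

    improve : ∀ {j r} → Approximates j r → ∃ λ r' → Approximates (suc j) r' × r' ≡ r [mod-p^ j + suc n ]
    improve {j} {r} (r²≡B , r≡r₀) =
      let r' , r'²≡B , r'≡r = hensel-step v' (ℕₚ.m≤n+m (suc n) j) r²≡B
      in r' , (r'²≡B , ≡-mod-trans (≡-mod-weaken (ℕₚ.m≤n+m (suc n) j) r'≡r) r≡r₀) , r'≡r
      where
      v' : HasVal (+ 2 * r) n
      v' = hasVal-cong ℕₚ.≤-refl (≡-mod-* (≡-mod-refl {x = + 2}) (≡-mod-sym r≡r₀)) v

    approx : ∀ j → ∃ (Approximates j)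
    approx zero = r₀ , r₀²≡B , ≡-mod-refl
    approx (suc j) = proj₁ (improve (proj₂ (approx j))) , proj₁ (proj₂ (improve (proj₂ (approx j))))

    root : Zp p
    root = record
      { seq = λ j → proj₁ (approx j)
      ; coh = λ j → p^∣⇒∣ᵤ (≡-mod⇒∣ (≡-mod-weaken (ℕₚ.m≤m+n j (suc n))
                                                    (proj₂ (proj₂ (improve (proj₂ (approx j)))))))
      }

    root²≡B : ∀ k → seq root k * seq root k ≡ B [mod-p^ k ]
    root²≡B k = ≡-mod-weaken (ℕₚ.≤-trans (ℕₚ.m≤m+n k (suc n)) (ℕₚ.m≤n+m _ n)) (proj₁ (proj₂ (approx k)))

    root≢0 : NonZeroₚ root
    root≢0 = suc n , λ d →
      proj₂ v (∣y⇒∣x*y (+ 2) (∣-resp-≡-mod (proj₂ (proj₂ (approx (suc n)))) (∣ᵤ⇒p^∣ d)))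

  module _ {δ : ℕ} (v₂ : HasVal (+ 2) δ) where

    close⇒product-square : ∀ {x x' m N} → HasVal x m → m + (δ + δ) < N → x ≡ x' [mod-p^ N ] →
                           IsSquareₚ (x * x')
    close⇒product-square {x} {x'} {m} {N} vx m+2δ<N (≡-mod p^N∣x-x') =
      hensel (hasVal-* v₂ vx)
        (≡-mod (∣-weaken exponent (subst (p^ m + N ∣_) (factor x x') (∣x∣y⇒∣x*y (proj₁ vx) p^N∣x-x'))))
      where
      factor : ∀ x x' → x * (x - x') ≡ x * x - x * x'
      factor = solve-∀
      exponent : δ + m + suc (δ + m) ≤ m + N
      exponent = subst (_≤ m + N) (rearrange m δ) (ℕₚ.+-monoʳ-≤ m m+2δ<N)
        where
        rearrange : ∀ m δ → m + suc (m + (δ + δ)) ≡ δ + m + suc (δ + m)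
        rearrange = ℕ-solve-∀

    close-square⇒square : ∀ {b β} f → HasVal b β → f * f ≡ b [mod-p^ suc (β + (δ + δ)) ] → IsSquareₚ b
    close-square⇒square {b} {β} f vb f²≡b =
      let m , _ , vf = hasVal-below {K = suc β} (λ p^∣f → proj₂ vf² (∣x⇒∣x*y f p^∣f))
      in hensel (hasVal-* v₂ vf) (≡-mod-weaken (ℕₚ.≤-reflexive (exponent vf)) f²≡b)
      where
      vf² : HasVal (f * f) β
      vf² = hasVal-cong (s≤s (ℕₚ.m≤m+n β (δ + δ))) (≡-mod-sym f²≡b) vb
      rearrange : ∀ m δ → δ + m + suc (δ + m) ≡ suc (m + m + (δ + δ))
      rearrange = ℕ-solve-∀
      exponent : ∀ {m} → HasVal f m → δ + m + suc (δ + m) ≡ suc (β + (δ + δ))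
      exponent {m} vf =
        trans (rearrange m δ) (cong (λ β → suc (β + (δ + δ))) (hasVal-unique (hasVal-* vf vf) vf²))

    HilbertOne-stable : ∀ {a a' b b' β N} c' f' → b' ≡ f' * f' - c' * a' → HasVal b β →
                        β + (δ + δ) + (δ + δ) < N → a ≡ a' [mod-p^ N ] → b ≡ b' [mod-p^ N ] →
                        HilbertOne p a b → HilbertOne p a' b'
    HilbertOne-stable {a} {a'} {b} {b'} {β} {N} c' f' b'≡f'²-c'a' vb bound a≡a' b≡b' =
      stable (p^∣? (suc (β + (δ + δ))) a)
      where
      β+2δ<N : β + (δ + δ) < N
      β+2δ<N = ℕₚ.≤-<-trans (ℕₚ.m≤m+n (β + (δ + δ)) (δ + δ)) bound

      m+2δ<N : ∀ {m} → m < suc (β + (δ + δ)) → m + (δ + δ) < N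
      m+2δ<N (s≤s m≤β+2δ) = ℕₚ.≤-<-trans (ℕₚ.+-monoˡ-≤ (δ + δ) m≤β+2δ) bound

      cancel : ∀ x y → x - (x - y) ≡ y
      cancel = solve-∀

      stable : Dec (p^ suc (β + (δ + δ)) ∣ a) → HilbertOne p a b → HilbertOne p a' b'
      stable (yes p^∣a) _ = square⇒HilbertOne a' b' (close-square⇒square f' vb' f'²≡b')
        where
        vb' : HasVal b' β
        vb' = hasVal-cong (ℕₚ.≤-<-trans (ℕₚ.m≤m+n β (δ + δ)) β+2δ<N) b≡b' vb
        f'²-b'≡c'a' : f' * f' - b' ≡ c' * a'
        f'²-b'≡c'a' = trans (cong (λ t → f' * f' - t) b'≡f'²-c'a') (cancel (f' * f') (c' * a'))
        f'²≡b' : f' * f' ≡ b' [mod-p^ suc (β + (δ + δ)) ]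
        f'²≡b' = ≡-mod (subst (p^ _ ∣_) (sym f'²-b'≡c'a')
          (∣y⇒∣x*y c' (∣-resp-≡-mod (≡-mod-weaken β+2δ<N a≡a') p^∣a)))
      stable (no p^∤a) =
        let m , m<β+2δ+1 , va = hasVal-below p^∤a
        in  HilbertOne-swap b' a'
          ∘ HilbertOne-resp-square-class b b' a' (proj₂ vb) (close⇒product-square vb β+2δ<N b≡b')
          ∘ HilbertOne-swap a' b
          ∘ HilbertOne-resp-square-class a a' b (proj₂ va)
              (close⇒product-square va (m+2δ<N m<β+2δ+1) a≡a')

lemma3p10 : (p : ℕ) → Prime p →
    (t₁ t₂ f : ℕ) → 2 < t₁ → 2 < t₂ → 0 < f →
    ℤ.0ℤ ℤ.< disc t₁ t₂ f →
    (β e : ℕ) → IsVal p (disc t₁ t₂ f) β → IsVal p (+ 16) e →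
    (t₁' t₂' f' : ℕ) → 2 < t₁' → 2 < t₂' → 0 < f' →
    ℤ.0ℤ ℤ.< disc t₁' t₂' f' →
    (+ t₁') ≡ (+ t₁) [mod p ^ (β + 1 + e) ] →
    (+ t₂') ≡ (+ t₂) [mod p ^ (β + 1 + e) ] →
    (+ f') ≡ (+ f) [mod p ^ (β + 1 + e) ] →
    HilbertOne p (tm t₂') (disc t₁' t₂' f') ⇔ HilbertOne p (tm t₂) (disc t₁ t₂ f)
lemma3p10 p p-prime t₁ t₂ f _ _ _ _ β e isVal-β isVal-e t₁' t₂' f' _ _ _ _ t₁'≡t₁ t₂'≡t₂ f'≡f =
  let δ , v₂ , 4δ≤e = valuation-of-2 (isVal⇒hasVal isVal-e)
      bound = subst₂ _<_ (sym (ℕₚ.+-assoc β (δ + δ) (δ + δ))) (sym (ℕₚ.+-assoc β 1 e))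
                         (ℕₚ.+-monoʳ-< β (s≤s 4δ≤e))
  in mk⇔ (HilbertOne-stable v₂ (tm t₁) (+ f) refl vβ' bound tm₂'≡tm₂ disc'≡disc)
         (HilbertOne-stable v₂ (tm t₁') (+ f') refl vβ bound (≡-mod-sym tm₂'≡tm₂) (≡-mod-sym disc'≡disc))
  where
  open PrimePowerDivisibility p p-prime
  N = β + 1 + e
  tm₂'≡tm₂ : tm t₂' ≡ tm t₂ [mod-p^ N ]
  tm₂'≡tm₂ = tm-cong (≡-modᵤ⇒≡-mod (+ t₂') (+ t₂) t₂'≡t₂)
  disc'≡disc : disc t₁' t₂' f' ≡ disc t₁ t₂ f [mod-p^ N ]
  disc'≡disc = disc-cong (≡-modᵤ⇒≡-mod (+ t₁') (+ t₁) t₁'≡t₁) (≡-modᵤ⇒≡-mod (+ t₂') (+ t₂) t₂'≡t₂)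
                         (≡-modᵤ⇒≡-mod (+ f') (+ f) f'≡f)
  vβ : HasVal (disc t₁ t₂ f) β
  vβ = isVal⇒hasVal isVal-β
  vβ' : HasVal (disc t₁' t₂' f') β
  vβ' = hasVal-cong (ℕₚ.≤-trans (ℕₚ.≤-reflexive (ℕₚ.+-comm 1 β)) (ℕₚ.m≤m+n (β + 1) e))
                    (≡-mod-sym disc'≡disc) vβ
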